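{- A finite simple graph $G$ has the property that every connected induced subgraph of $G$ is geodetic if and only if $G$ contains no induced subgraph isomorphic to a cycle $C_{2k}$ with $k\ge 2$ and no induced subgraph isomorphic to a member of $\mathcal C'_{2k}$ with $k\ge 2$. That is, $\lfloor\mathcal G\rfloor = \mathrm{Free}(C_{2k},\mathcal C'_{2k}\mid k\ge 2)$.
   Context: A geodesic is a shortest path; a graph is geodetic if between any two vertices there is exactly one geodesic. $\lfloor\mathcal G\rfloor$ is the maximal hereditary subclass of the class of geodetic graphs, i.e. the graphs all of whose connected induced subgraphs are geodetic. $\mathcal C'_{2k}$ is the set of graphs obtained from a cycle on $2k$ vertices by adding one chord that divides the cycle into two cycles of odd length. $\mathrm{Free}(M)$ is the class of graphs containing no graph of $M$ as an induced subgraph. -}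

module Defs where

open import Data.Nat using (ℕ; zero; suc; _+_; _*_; _∸_; _≤_; _<_)
open import Data.Nat.Properties using () renaming (_≟_ to _≟ℕ_)
open import Data.Fin using (Fin; toℕ; _≟_)
open import Data.Bool using (Bool; true; false; _∧_; _∨_; not; T)
open import Data.Bool.Properties using (∨-comm)
open import Data.List using (List; []; _∷_; length)
open import Data.Product using (Σ; ∃; _×_; _,_)
open import Relation.Nullary using (¬_; does)
open import Relation.Nullary.Decidable using (⌊_⌋)
open import Relation.Binary.PropositionalEquality using (_≡_; refl; cong)
open import Function using (Injective)

record Graph : Set where
  field
    n      : ℕ
    adj    : Fin n → Fin n → Bool
    sym    : ∀ u v → adj u v ≡ adj v u
    irrefl : ∀ u → adj u u ≡ false
open Graph public

Adj : (G : Graph) → Fin (n G) → Fin (n G) → Set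
Adj G u v = T (adj G u v)

simpleAdj : ∀ {m} → (Fin m → Fin m → Bool) → Fin m → Fin m → Bool
simpleAdj r u v = not ⌊ u ≟ v ⌋ ∧ (r u v ∨ r v u)

private
  ≟-sym : ∀ {m} (u v : Fin m) → ⌊ u ≟ v ⌋ ≡ ⌊ v ≟ u ⌋
  ≟-sym u v with u ≟ v | v ≟ u
  ... | Relation.Nullary.yes _ | Relation.Nullary.yes _ = refl
  ... | Relation.Nullary.no _  | Relation.Nullary.no _  = refl
  ... | Relation.Nullary.yes refl | Relation.Nullary.no ¬p with ¬p refl
  ...   | ()
  ≟-sym u v | Relation.Nullary.no ¬p | Relation.Nullary.yes refl with ¬p refl
  ...   | ()

  ≟-refl : ∀ {m} (u : Fin m) → ⌊ u ≟ u ⌋ ≡ true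
  ≟-refl u with u ≟ u
  ... | Relation.Nullary.yes _ = refl
  ... | Relation.Nullary.no ¬p with ¬p refl
  ...   | ()

fromRel : (m : ℕ) → (Fin m → Fin m → Bool) → Graph
fromRel m r = record
  { n = m
  ; adj = simpleAdj r
  ; sym = λ u v → Relation.Binary.PropositionalEquality.cong₂ _∧_
            (cong not (≟-sym u v)) (∨-comm (r u v) (r v u))
  ; irrefl = λ u → Relation.Binary.PropositionalEquality.cong
            (λ b → not b ∧ (r u u ∨ r u u)) (≟-refl u)
  }

-- Induced subgraphs: H is (isomorphic to) an induced subgraph of G iff
-- there is an injective vertex map preserving adjacency and non-adjacency.

record _↪_ (H G : Graph) : Set where
  field
    f      : Fin (n H) → Fin (n G)
    inj    : Injective _≡_ _≡_ f
    adjPre : ∀ u v → adj H u v ≡ adj G (f u) (f v)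

FreeOf : Graph → Graph → Set
FreeOf H G = ¬ (H ↪ G)

data Walk (G : Graph) : Fin (n G) → Fin (n G) → Set where
  here : ∀ {u} → Walk G u u
  step : ∀ {u w v} → Adj G u w → Walk G w v → Walk G u v

len : ∀ {G u v} → Walk G u v → ℕ
len here       = 0
len (step _ p) = suc (len p)

vertices : ∀ {G u v} → Walk G u v → List (Fin (n G))
vertices {u = u} here       = u ∷ []
vertices {u = u} (step _ p) = u ∷ vertices p

Connected : Graph → Set
Connected G = ∀ u v → Walk G u v

IsGeodesic : ∀ {G u v} → Walk G u v → Set
IsGeodesic {G} {u} {v} p = ∀ (q : Walk G u v) → len p ≤ len q

Geodetic : Graph → Set
Geodetic G = ∀ u v →
  Σ (Walk G u v) IsGeodesic ×
  (∀ (p q : Walk G u v) → IsGeodesic p → IsGeodesic q → vertices p ≡ vertices q)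

AllConnectedInducedGeodetic : Graph → Set
AllConnectedInducedGeodetic G = ∀ (H : Graph) → H ↪ G → Connected H → Geodetic H

-- consecutive on the cycle 0,1,…,m-1,0  (for m ≥ 3)
cycRel : (m : ℕ) → Fin m → Fin m → Bool
cycRel m u v = ⌊ suc (toℕ u) ≟ℕ toℕ v ⌋ ∨ (⌊ toℕ v ≟ℕ 0 ⌋ ∧ ⌊ suc (toℕ u) ≟ℕ m ⌋)

Cycle : ℕ → Graph
Cycle m = fromRel m (cycRel m)

ChordedCycle : (m : ℕ) → Fin m → Fin m → Graph
ChordedCycle m a b =
  fromRel m (λ u v → cycRel m u v ∨ (⌊ u ≟ a ⌋ ∧ ⌊ v ≟ b ⌋))

Odd : ℕ → Set
Odd x = ∃ λ j → x ≡ suc (2 * j)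

-- {a , b} with a < b is a chord (non-edge of the cycle) of C_m dividing it
-- into the two cycles of lengths (b - a) + 1 and (m - (b - a)) + 1, both odd.
OddChord : (m : ℕ) → Fin m → Fin m → Set
OddChord m a b =
  toℕ a < toℕ b × 2 ≤ toℕ b ∸ toℕ a × toℕ b ∸ toℕ a + 2 ≤ m ×
  Odd (toℕ b ∸ toℕ a + 1) × Odd (m ∸ (toℕ b ∸ toℕ a) + 1)

FreeEvenCyclesAndOddChorded : Graph → Set
FreeEvenCyclesAndOddChorded G =
  (∀ k → 2 ≤ k → FreeOf (Cycle (2 * k)) G) ×
  (∀ k → 2 ≤ k → ∀ (a b : Fin (2 * k)) → OddChord (2 * k) a b →
     FreeOf (ChordedCycle (2 * k) a b) G)

{-# OPTIONS --safe #-}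
-- Let m = 2k and centre the cycle at a vertex c (for the chorded cycle, at the midpoint
-- of the even arc between the chord ends).  The distance to c along the cycle changes by at most one along
-- every edge, the chord joining two vertices at the same distance from c.  Hence both arcs of length k from c
-- to its antipode are geodesics, and these connected graphs are not geodetic.
--
-- By strong induction on d, geodesics of length d are unique.  Two distinct geodesics P
-- and Q of minimal length d meet only at their ends; every edge between them is a rung P i — Q i; and there
-- is at most one rung, since two rungs give two geodesics of smaller length that differ at their second
-- vertex.  So P followed by Q backwards is an induced cycle of length 2d with at most one chord, joining
-- positions i and 2d − i, which cuts it into cycles of the odd lengths 2i + 1 and 2(d − i) + 1.
module Submission where

open import Defs hiding (sym)
open import Function.Base using (_∘_)
open import Function.Bundles using (_⇔_; mk⇔; Equivalence)
open import Data.Nat using (ℕ; zero; suc; _+_; _*_; _∸_; _⊓_; _≤_; _<_; _≤?_; _<?_)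
open import Data.Nat using (z≤n; s≤s; s≤s⁻¹; z<s; NonZero; >-nonZero)
open import Data.Nat.Properties
open import Data.Nat.Properties using () renaming (_≟_ to _≟ⁿ_)
open import Data.Nat.Tactic.RingSolver using (solve-∀)
open import Data.Nat.Induction using (<-rec)
open import Data.Fin using (Fin; toℕ; fromℕ<) renaming (_≟_ to _≟ᶠ_)
open import Data.Fin.Properties using (toℕ-injective; toℕ-fromℕ<; toℕ<n; any?)
open import Data.Bool using (Bool; true; false; T; _∨_; _∧_)
open import Data.Bool.Properties using (T-∧; T-∨)
open import Data.Unit using (tt)
open import Data.Empty using (⊥; ⊥-elim)
open import Data.List using (_∷_; applyUpTo)
open import Data.List.Properties using (∷-injectiveˡ; ∷-injectiveʳ)
open import Data.Product using (Σ; ∃; _×_; _,_; proj₁; proj₂)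
open import Data.Sum using (_⊎_; inj₁; inj₂)
import Data.Sum as Sum
open import Relation.Nullary using (¬_; Dec; yes; no; contradiction)
open import Relation.Nullary.Decidable using (⌊_⌋; toWitness; fromWitness; T?; _×-dec_; decidable-stable)
open import Relation.Binary.PropositionalEquality
open import Relation.Binary.Definitions using (tri<; tri≈; tri>)

T-⇔⇒≡ : ∀ {b c} → (T b ⇔ T c) → b ≡ c
T-⇔⇒≡ {false} {false} _ = refl
T-⇔⇒≡ {false} {true}  b⇔c = ⊥-elim (Equivalence.from b⇔c tt)
T-⇔⇒≡ {true}  {false} b⇔c = ⊥-elim (Equivalence.to b⇔c tt)
T-⇔⇒≡ {true}  {true}  _ = refl

Adj-sym : ∀ G {a b} → Adj G a b → Adj G b a
Adj-sym G {a} {b} = subst T (Graph.sym G a b)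

Adj-irrefl : ∀ G {a} → ¬ Adj G a a
Adj-irrefl G {a} = subst T (Graph.irrefl G a)

↪-trans : ∀ {K H G} → K ↪ H → H ↪ G → K ↪ G
↪-trans K↪H H↪G = record
  { f      = H↪G.f ∘ K↪H.f
  ; inj    = K↪H.inj ∘ H↪G.inj
  ; adjPre = λ u v → trans (K↪H.adjPre u v) (H↪G.adjPre _ _)
  }
  where module K↪H = _↪_ K↪H
        module H↪G = _↪_ H↪G

module _ {m : ℕ} (r : Fin m → Fin m → Bool) where

  fromRel-adj⇔ : (∀ {x y} → T (r x y) → x ≢ y) →
                 ∀ {x y} → Adj (fromRel m r) x y ⇔ (T (r x y) ⊎ T (r y x))
  fromRel-adj⇔ r-irrefl {x} {y} with x ≟ᶠ y
  ... | no _    = mk⇔ (Equivalence.to T-∨) (Equivalence.from T-∨)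
  ... | yes refl = mk⇔ (λ ()) λ { (inj₁ rxx) → contradiction refl (r-irrefl rxx)
                                 ; (inj₂ rxx) → contradiction refl (r-irrefl rxx) }

CycSucc : ℕ → ℕ → ℕ → Set
CycSucc m a b = suc a ≡ b ⊎ (b ≡ 0 × suc a ≡ m)

CycAdj : ℕ → ℕ → ℕ → Set
CycAdj m a b = CycSucc m a b ⊎ CycSucc m b a

CycSucc-irrefl : ∀ {m a b} → 2 ≤ m → CycSucc m a b → a ≢ b
CycSucc-irrefl _               (inj₁ 1+a≡a)     refl = 1+n≢n 1+a≡a
CycSucc-irrefl (s≤s (s≤s z≤n)) (inj₂ (refl , ())) refl

T-cycRel⇔ : ∀ {m} {x y : Fin m} → T (cycRel m x y) ⇔ CycSucc m (toℕ x) (toℕ y)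
T-cycRel⇔ = mk⇔ to from
  where
    to : ∀ {m} {x y : Fin m} → T (cycRel m x y) → CycSucc m (toℕ x) (toℕ y)
    to {x = x} {y} h with Equivalence.to (T-∨ {⌊ suc (toℕ x) ≟ⁿ toℕ y ⌋}) h
    ... | inj₁ succ = inj₁ (toWitness succ)
    ... | inj₂ wrap = let (y≡0 , 1+x≡m) = Equivalence.to (T-∧ {⌊ toℕ y ≟ⁿ 0 ⌋}) wrap in
                      inj₂ (toWitness y≡0 , toWitness 1+x≡m)
    from : ∀ {m} {x y : Fin m} → CycSucc m (toℕ x) (toℕ y) → T (cycRel m x y)
    from {x = x} {y} (inj₁ succ) =
      Equivalence.from (T-∨ {⌊ suc (toℕ x) ≟ⁿ toℕ y ⌋}) (inj₁ (fromWitness succ))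
    from {x = x} {y} (inj₂ (y≡0 , 1+x≡m)) =
      Equivalence.from (T-∨ {⌊ suc (toℕ x) ≟ⁿ toℕ y ⌋})
        (inj₂ (Equivalence.from (T-∧ {⌊ toℕ y ≟ⁿ 0 ⌋}) (fromWitness y≡0 , fromWitness 1+x≡m)))

Cycle-adj⇔ : ∀ {m} → 2 ≤ m → ∀ {x y : Fin m} → Adj (Cycle m) x y ⇔ CycAdj m (toℕ x) (toℕ y)
Cycle-adj⇔ {m} 2≤m {x} {y} = mk⇔
  (Sum.map to to ∘ Equivalence.to adj⇔)
  (Equivalence.from adj⇔ ∘ Sum.map from from)
  where
    to : ∀ {u v : Fin m} → T (cycRel m u v) → CycSucc m (toℕ u) (toℕ v)
    to = Equivalence.to T-cycRel⇔
    from : ∀ {u v : Fin m} → CycSucc m (toℕ u) (toℕ v) → T (cycRel m u v)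
    from = Equivalence.from T-cycRel⇔
    adj⇔ = fromRel-adj⇔ (cycRel m) (λ r u≡v → CycSucc-irrefl 2≤m (to r) (cong toℕ u≡v)) {x} {y}

ChordSucc : (m : ℕ) → Fin m → Fin m → Fin m → Fin m → Set
ChordSucc m a b x y = CycSucc m (toℕ x) (toℕ y) ⊎ (x ≡ a × y ≡ b)

chordedCycRel : (m : ℕ) → Fin m → Fin m → Fin m → Fin m → Bool
chordedCycRel m a b u v = cycRel m u v ∨ (⌊ u ≟ᶠ a ⌋ ∧ ⌊ v ≟ᶠ b ⌋)

ChordedCycle-adj⇔ : ∀ {m} {a b : Fin m} → 2 ≤ m → a ≢ b → ∀ {x y} →
                    Adj (ChordedCycle m a b) x y ⇔ (ChordSucc m a b x y ⊎ ChordSucc m a b y x)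
ChordedCycle-adj⇔ {m} {a} {b} 2≤m a≢b {x} {y} = mk⇔
  (Sum.map to to ∘ Equivalence.to adj⇔)
  (Equivalence.from adj⇔ ∘ Sum.map from from)
  where
    r = chordedCycRel m a b
    to : ∀ {u v} → T (r u v) → ChordSucc m a b u v
    to {u} {v} h with Equivalence.to (T-∨ {cycRel m u v}) h
    ... | inj₁ cyc   = inj₁ (Equivalence.to T-cycRel⇔ cyc)
    ... | inj₂ chord = let (u≡a , v≡b) = Equivalence.to (T-∧ {⌊ u ≟ᶠ a ⌋}) chord in
                       inj₂ (toWitness u≡a , toWitness v≡b)
    from : ∀ {u v} → ChordSucc m a b u v → T (r u v)
    from {u} {v} (inj₁ cyc) =
      Equivalence.from (T-∨ {cycRel m u v}) (inj₁ (Equivalence.from T-cycRel⇔ cyc))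
    from {u} {v} (inj₂ (u≡a , v≡b)) =
      Equivalence.from (T-∨ {cycRel m u v})
        (inj₂ (Equivalence.from (T-∧ {⌊ u ≟ᶠ a ⌋}) (fromWitness u≡a , fromWitness v≡b)))
    r-irrefl : ∀ {u v} → T (r u v) → u ≢ v
    r-irrefl ruv with to ruv
    ... | inj₁ cyc          = λ u≡v → CycSucc-irrefl 2≤m cyc (cong toℕ u≡v)
    ... | inj₂ (refl , refl) = a≢b
    adj⇔ = fromRel-adj⇔ r r-irrefl {x} {y}

applyUpTo-cong : ∀ {A : Set} {f g : ℕ → A} n → (∀ {t} → t < n → f t ≡ g t) →
                 applyUpTo f n ≡ applyUpTo g n
applyUpTo-cong zero    f≗g = refl
applyUpTo-cong (suc n) f≗g = cong₂ _∷_ (f≗g z<s) (applyUpTo-cong n (f≗g ∘ s≤s))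

applyUpTo-differ₁ : ∀ {A : Set} {f g : ℕ → A} {n} → 1 ≤ n → f 1 ≢ g 1 →
                    applyUpTo f (suc n) ≢ applyUpTo g (suc n)
applyUpTo-differ₁ {n = suc _} _ f1≢g1 eq = f1≢g1 (∷-injectiveˡ (∷-injectiveʳ eq))

1+[m∸n]≡m∸o⇒1+o≡n : ∀ {m n o} → n ≤ m → o ≤ m → suc (m ∸ n) ≡ m ∸ o → suc o ≡ n
1+[m∸n]≡m∸o⇒1+o≡n {m} {n} {o} n≤m o≤m eq = +-cancelˡ-≡ (m ∸ n) (suc o) n (begin
  m ∸ n + suc o     ≡⟨ +-suc (m ∸ n) o ⟩
  suc (m ∸ n) + o   ≡⟨ cong (_+ o) eq ⟩
  m ∸ o + o         ≡⟨ m∸n+n≡m o≤m ⟩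
  m                 ≡⟨ sym (m∸n+n≡m n≤m) ⟩
  m ∸ n + n         ∎)
  where open ≡-Reasoning

module Walks (G : Graph) where

  V : Set
  V = Fin (n G)

  infixr 5 _++ʷ_
  _++ʷ_ : ∀ {a b c} → Walk G a b → Walk G b c → Walk G a c
  here     ++ʷ q = q
  step h p ++ʷ q = step h (p ++ʷ q)

  len-++ʷ : ∀ {a b c} (p : Walk G a b) (q : Walk G b c) → len (p ++ʷ q) ≡ len p + len q
  len-++ʷ here       q = refl
  len-++ʷ (step h p) q = cong suc (len-++ʷ p q)

  reverseʷ : ∀ {a b} → Walk G a b → Walk G b a
  reverseʷ here       = here
  reverseʷ (step h p) = reverseʷ p ++ʷ step (Adj-sym G h) here

  -- Walks as vertex sequences x 0, …, x L, so that geodesics can be cut and spliced by index arithmetic.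
  Chain : (ℕ → V) → ℕ → Set
  Chain x L = ∀ t → t < L → Adj G (x t) (x (suc t))

  chainWalk : ∀ x L → Chain x L → Walk G (x 0) (x L)
  chainWalk x zero    ch = here
  chainWalk x (suc L) ch = step (ch 0 z<s) (chainWalk (x ∘ suc) L (λ t → ch (suc t) ∘ s≤s))

  len-chainWalk : ∀ x L ch → len (chainWalk x L ch) ≡ L
  len-chainWalk x zero    ch = refl
  len-chainWalk x (suc L) ch = cong suc (len-chainWalk (x ∘ suc) L _)

  vertices-chainWalk : ∀ x L ch → vertices (chainWalk x L ch) ≡ applyUpTo x (suc L)
  vertices-chainWalk x zero    ch = refl
  vertices-chainWalk x (suc L) ch = cong (x 0 ∷_) (vertices-chainWalk (x ∘ suc) L _)

  chain⇒walk : ∀ {a b} x L → Chain x L → x 0 ≡ a → x L ≡ b →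
               Σ (Walk G a b) λ w → len w ≡ L × vertices w ≡ applyUpTo x (suc L)
  chain⇒walk x L ch refl refl = chainWalk x L ch , len-chainWalk x L ch , vertices-chainWalk x L ch

  vertexAt : ∀ {a b} → Walk G a b → ℕ → V
  vertexAt {a} here       _       = a
  vertexAt {a} (step _ _) zero    = a
  vertexAt     (step _ p) (suc t) = vertexAt p t

  vertexAt-0 : ∀ {a b} (p : Walk G a b) → vertexAt p 0 ≡ a
  vertexAt-0 here       = refl
  vertexAt-0 (step _ _) = refl

  vertexAt-len : ∀ {a b} (p : Walk G a b) → vertexAt p (len p) ≡ b
  vertexAt-len here       = refl
  vertexAt-len (step _ p) = vertexAt-len p

  vertexAt-chain : ∀ {a b} (p : Walk G a b) → Chain (vertexAt p) (len p)
  vertexAt-chain (step h p) zero    _         = subst (Adj G _) (sym (vertexAt-0 p)) h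
  vertexAt-chain (step h p) (suc t) (s≤s t<L) = vertexAt-chain p t t<L

  vertices-vertexAt : ∀ {a b} (p : Walk G a b) → vertices p ≡ applyUpTo (vertexAt p) (suc (len p))
  vertices-vertexAt here       = refl
  vertices-vertexAt (step _ p) = cong (_ ∷_) (vertices-vertexAt p)

  splice : (ℕ → V) → ℕ → (ℕ → V) → ℕ → V
  splice x i y t with t ≤? i
  ... | yes _ = x t
  ... | no  _ = y (t ∸ i)

  splice-≤ : ∀ x i y {t} → t ≤ i → splice x i y t ≡ x t
  splice-≤ x i y {t} t≤i with t ≤? i
  ... | yes _   = refl
  ... | no  t≰i = contradiction t≤i t≰i

  splice-≥ : ∀ x i y {t} → x i ≡ y 0 → i ≤ t → splice x i y t ≡ y (t ∸ i)
  splice-≥ x i y {t} xi≡y0 i≤t with t ≤? i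
  ... | no  _   = refl
  ... | yes t≤i with ≤-antisym t≤i i≤t
  ...   | refl = trans xi≡y0 (cong y (sym (n∸n≡0 t)))

  splice-chain : ∀ x i y {L} → Chain x i → Chain y L → x i ≡ y 0 → Chain (splice x i y) (i + L)
  splice-chain x i y {L} chx chy xi≡y0 t t<i+L with <-≤-connex t i
  ... | inj₁ t<i = subst₂ (Adj G) (sym (splice-≤ x i y (<⇒≤ t<i))) (sym (splice-≤ x i y t<i)) (chx t t<i)
  ... | inj₂ i≤t = subst₂ (Adj G) (sym (splice-≥ x i y xi≡y0 i≤t))
                     (sym (trans (splice-≥ x i y xi≡y0 (m≤n⇒m≤1+n i≤t)) (cong y (+-∸-assoc 1 i≤t))))
                     (chy (t ∸ i) (subst (t ∸ i <_) (m+n∸m≡n i L) (∸-monoˡ-< t<i+L i≤t)))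

  edge : V → V → ℕ → V
  edge a b zero    = a
  edge a b (suc _) = b

  edge-chain : ∀ {a b} → Adj G a b → Chain (edge a b) 1
  edge-chain a~b zero z<s = a~b

  Lipschitz : (V → ℕ) → Set
  Lipschitz φ = ∀ {a b} → Adj G a b → φ b ≤ suc (φ a)

  Lipschitz-walk : ∀ {φ} → Lipschitz φ → ∀ {a b} (p : Walk G a b) → φ b ≤ φ a + len p
  Lipschitz-walk {φ} lip {a} here = ≤-reflexive (sym (+-identityʳ (φ a)))
  Lipschitz-walk {φ} lip {a} (step {w = w} h p) = begin
    φ _             ≤⟨ Lipschitz-walk lip p ⟩
    φ w + len p     ≤⟨ +-monoˡ-≤ (len p) (lip h) ⟩
    suc (φ a) + len p ≡⟨ sym (+-suc (φ a) (len p)) ⟩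
    φ a + suc (len p) ∎
    where open ≤-Reasoning

  Lipschitz-tight⇒geodesic : ∀ {φ} → Lipschitz φ → ∀ {a b} (p : Walk G a b) →
                             φ a + len p ≤ φ b → IsGeodesic p
  Lipschitz-tight⇒geodesic {φ} lip {a} p tight q =
    +-cancelˡ-≤ (φ a) (len p) (len q) (≤-trans tight (Lipschitz-walk lip q))

-- For a, s < m, rot a ≡ a − c and unrot s ≡ s + c modulo m;
-- cdist a is the distance from c to a along the m-cycle.
module Rotation (m c : ℕ) (c<m : c < m) where

  0<m : 0 < m
  0<m = ≤-<-trans z≤n c<m

  instance
    m-nonZero : NonZero m
    m-nonZero = >-nonZero 0<m

  rot : ℕ → ℕ
  rot a with c ≤? a
  ... | yes _ = a ∸ c
  ... | no  _ = a + m ∸ c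

  rot-≥ : ∀ {a} → c ≤ a → rot a ≡ a ∸ c
  rot-≥ {a} c≤a with c ≤? a
  ... | yes _   = refl
  ... | no  c≰a = contradiction c≤a c≰a

  rot-< : ∀ {a} → a < c → rot a ≡ a + m ∸ c
  rot-< {a} a<c with c ≤? a
  ... | yes c≤a = contradiction c≤a (<⇒≱ a<c)
  ... | no  _   = refl

  rot<m : ∀ {a} → a < m → rot a < m
  rot<m {a} a<m with ≤-<-connex c a
  ... | inj₁ c≤a = subst (_< m) (sym (rot-≥ c≤a)) (≤-<-trans (m∸n≤m a c) a<m)
  ... | inj₂ a<c = subst (_< m) (sym (rot-< a<c)) (m<n+o⇒m∸n<o (a + m) c (+-monoˡ-< m a<c))

  c≤a+m : ∀ a → c ≤ a + m
  c≤a+m a = ≤-trans (<⇒≤ c<m) (m≤n+m m a)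

  rot-suc : ∀ a → CycSucc m (rot a) (rot (suc a))
  rot-suc a with ≤-<-connex c a | ≤-<-connex c (suc a)
  ... | inj₁ c≤a | _ = inj₁ (begin
    suc (rot a)   ≡⟨ cong suc (rot-≥ c≤a) ⟩
    suc (a ∸ c)   ≡⟨ sym (+-∸-assoc 1 c≤a) ⟩
    suc a ∸ c     ≡⟨ sym (rot-≥ (m≤n⇒m≤1+n c≤a)) ⟩
    rot (suc a)   ∎)
    where open ≡-Reasoning
  ... | inj₂ a<c | inj₂ 1+a<c = inj₁ (begin
    suc (rot a)       ≡⟨ cong suc (rot-< a<c) ⟩
    suc (a + m ∸ c)   ≡⟨ sym (+-∸-assoc 1 (c≤a+m a)) ⟩
    suc a + m ∸ c     ≡⟨ sym (rot-< 1+a<c) ⟩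
    rot (suc a)       ∎)
    where open ≡-Reasoning
  ... | inj₂ a<c | inj₁ c≤1+a = inj₂ (rot-c≡0 , wrap)
    where
      open ≡-Reasoning
      c≡1+a : c ≡ suc a
      c≡1+a = ≤-antisym c≤1+a a<c
      rot-c≡0 : rot (suc a) ≡ 0
      rot-c≡0 = trans (rot-≥ c≤1+a) (trans (cong (suc a ∸_) c≡1+a) (n∸n≡0 (suc a)))
      wrap : suc (rot a) ≡ m
      wrap = begin
        suc (rot a)            ≡⟨ cong suc (rot-< a<c) ⟩
        suc (a + m ∸ c)        ≡⟨ cong (λ z → suc (a + m ∸ z)) (trans c≡1+a (+-comm 1 a)) ⟩
        suc (a + m ∸ (a + 1))  ≡⟨ cong suc ([m+n]∸[m+o]≡n∸o a m 1) ⟩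
        suc (m ∸ 1)            ≡⟨ suc-pred m ⟩
        m                      ∎

  rot-wrap : ∀ {a} → suc a ≡ m → CycSucc m (rot a) (rot 0)
  rot-wrap {a} 1+a≡m with ≤-<-connex c 0
  ... | inj₁ c≤0 = inj₂ (trans (rot-≥ c≤0) (0∸n≡0 c) ,
                        trans (cong suc (trans (rot-≥ c≤a) (cong (a ∸_) (n≤0⇒n≡0 c≤0)))) 1+a≡m)
    where c≤a = s≤s⁻¹ (subst (c <_) (sym 1+a≡m) c<m)
  ... | inj₂ 0<c = inj₁ (begin
    suc (rot a)  ≡⟨ cong suc (rot-≥ c≤a) ⟩
    suc (a ∸ c)  ≡⟨ sym (+-∸-assoc 1 c≤a) ⟩
    suc a ∸ c    ≡⟨ cong (_∸ c) 1+a≡m ⟩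
    m ∸ c        ≡⟨ sym (rot-< 0<c) ⟩
    rot 0        ∎)
    where open ≡-Reasoning
          c≤a = s≤s⁻¹ (subst (c <_) (sym 1+a≡m) c<m)

  rot-succ : ∀ {a b} → CycSucc m a b → CycSucc m (rot a) (rot b)
  rot-succ (inj₁ refl)           = rot-suc _
  rot-succ (inj₂ (refl , 1+a≡m)) = rot-wrap 1+a≡m

  cdist₀ : ℕ → ℕ
  cdist₀ s = s ⊓ (m ∸ s)

  cdist₀-succ : ∀ {s s′} → CycSucc m s s′ → s < m →
                cdist₀ s′ ≤ suc (cdist₀ s) × cdist₀ s ≤ suc (cdist₀ s′)
  cdist₀-succ {s} (inj₁ refl) s<m =
    ⊓-mono-≤ ≤-refl (≤-trans (∸-monoʳ-≤ m (n≤1+n s)) (n≤1+n (m ∸ s))) ,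
    ⊓-mono-≤ (≤-trans (n≤1+n s) (n≤1+n (suc s))) (≤-reflexive (+-∸-assoc 1 s<m))
  cdist₀-succ {s} (inj₂ (refl , 1+s≡m)) _ =
    z≤n , m≤n⇒o⊓m≤n s (≤-reflexive (trans (cong (_∸ s) (sym 1+s≡m)) (m+n∸n≡m 1 s)))

  cdist : ℕ → ℕ
  cdist a = cdist₀ (rot a)

  cdist-adj : ∀ {a b} → CycAdj m a b → a < m → b < m → cdist b ≤ suc (cdist a)
  cdist-adj (inj₁ a→b) a<m _   = proj₁ (cdist₀-succ (rot-succ a→b) (rot<m a<m))
  cdist-adj (inj₂ b→a) _   b<m = proj₂ (cdist₀-succ (rot-succ b→a) (rot<m b<m))

  unrot : ℕ → ℕ
  unrot s with s + c <? m
  ... | yes _ = s + c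
  ... | no  _ = s + c ∸ m

  unrot-< : ∀ {s} → s + c < m → unrot s ≡ s + c
  unrot-< {s} s+c<m with s + c <? m
  ... | yes _     = refl
  ... | no  s+c≮m = contradiction s+c<m s+c≮m

  unrot-≥ : ∀ {s} → m ≤ s + c → unrot s ≡ s + c ∸ m
  unrot-≥ {s} m≤s+c with s + c <? m
  ... | yes s+c<m = contradiction m≤s+c (<⇒≱ s+c<m)
  ... | no  _     = refl

  unrot<m : ∀ {s} → s ≤ m → unrot s < m
  unrot<m {s} s≤m with <-≤-connex (s + c) m
  ... | inj₁ s+c<m = subst (_< m) (sym (unrot-< s+c<m)) s+c<m
  ... | inj₂ m≤s+c = subst (_< m) (sym (unrot-≥ m≤s+c)) (m<n+o⇒m∸n<o (s + c) m (+-mono-≤-< s≤m c<m))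

  rot-unrot : ∀ {s} → s < m → rot (unrot s) ≡ s
  rot-unrot {s} s<m with <-≤-connex (s + c) m
  ... | inj₁ s+c<m = begin
    rot (unrot s)   ≡⟨ cong rot (unrot-< s+c<m) ⟩
    rot (s + c)     ≡⟨ rot-≥ (m≤n+m c s) ⟩
    s + c ∸ c       ≡⟨ m+n∸n≡m s c ⟩
    s               ∎
    where open ≡-Reasoning
  ... | inj₂ m≤s+c = begin
    rot (unrot s)       ≡⟨ cong rot (unrot-≥ m≤s+c) ⟩
    rot (s + c ∸ m)     ≡⟨ rot-< (m<n+o⇒m∸n<o (s + c) m {{>-nonZero 0<c}} (+-monoˡ-< c s<m)) ⟩
    s + c ∸ m + m ∸ c   ≡⟨ cong (_∸ c) (m∸n+n≡m m≤s+c) ⟩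
    s + c ∸ c           ≡⟨ m+n∸n≡m s c ⟩
    s                   ∎
    where
      open ≡-Reasoning
      0<c : 0 < c
      0<c = +-cancelˡ-< s 0 c (<-≤-trans (subst (_< m) (sym (+-identityʳ s)) s<m) m≤s+c)

  unrot-rot : ∀ {a} → a < m → unrot (rot a) ≡ a
  unrot-rot {a} a<m with ≤-<-connex c a
  ... | inj₁ c≤a = begin
    unrot (rot a)   ≡⟨ cong unrot (rot-≥ c≤a) ⟩
    unrot (a ∸ c)   ≡⟨ unrot-< (subst (_< m) (sym (m∸n+n≡m c≤a)) a<m) ⟩
    a ∸ c + c       ≡⟨ m∸n+n≡m c≤a ⟩
    a               ∎
    where open ≡-Reasoning
  ... | inj₂ a<c = begin
    unrot (rot a)       ≡⟨ cong unrot (rot-< a<c) ⟩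
    unrot (a + m ∸ c)   ≡⟨ unrot-≥ (subst (m ≤_) (sym (m∸n+n≡m (c≤a+m a))) (m≤n+m m a)) ⟩
    a + m ∸ c + c ∸ m   ≡⟨ cong (_∸ m) (m∸n+n≡m (c≤a+m a)) ⟩
    a + m ∸ m           ≡⟨ m+n∸n≡m a m ⟩
    a                   ∎
    where open ≡-Reasoning

  unrot-0 : unrot 0 ≡ c
  unrot-0 = unrot-< c<m

  unrot-m : unrot m ≡ c
  unrot-m = trans (unrot-≥ (m≤m+n m c)) (m+n∸m≡n m c)

  unrot-succ : ∀ {s} → s < m → CycSucc m (unrot s) (unrot (suc s))
  unrot-succ {s} s<m with <-≤-connex (suc s + c) m | <-≤-connex (s + c) m
  ... | inj₁ 1+s+c<m | _ =
    inj₁ (trans (cong suc (unrot-< (<-trans (n<1+n (s + c)) 1+s+c<m))) (sym (unrot-< 1+s+c<m)))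
  ... | inj₂ m≤1+s+c | inj₁ s+c<m =
    inj₂ (trans (unrot-≥ m≤1+s+c) (trans (cong (suc s + c ∸_) (sym 1+s+c≡m)) (n∸n≡0 (suc s + c))) ,
          trans (cong suc (unrot-< s+c<m)) 1+s+c≡m)
    where 1+s+c≡m = ≤-antisym s+c<m m≤1+s+c
  ... | inj₂ m≤1+s+c | inj₂ m≤s+c =
    inj₁ (trans (cong suc (unrot-≥ m≤s+c)) (trans (sym (+-∸-assoc 1 m≤s+c)) (sym (unrot-≥ m≤1+s+c))))

module AntipodalGeodesics
  (k : ℕ) (2≤k : 2 ≤ k) (c : ℕ) (c<2k : c < 2 * k) (r : Fin (2 * k) → Fin (2 * k) → Bool)
  (succ⇒adj : ∀ {x y} → CycSucc (2 * k) (toℕ x) (toℕ y) → Adj (fromRel (2 * k) r) x y)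
  (adj⇒ : ∀ {x y} → Adj (fromRel (2 * k) r) x y →
          CycAdj (2 * k) (toℕ x) (toℕ y) ⊎
          Rotation.cdist (2 * k) c c<2k (toℕ x) ≡ Rotation.cdist (2 * k) c c<2k (toℕ y))
  where

  m : ℕ
  m = 2 * k

  K : Graph
  K = fromRel m r

  open Rotation m c c<2k
  open Walks K

  k+k≡m : k + k ≡ m
  k+k≡m = cong (k +_) (sym (+-identityʳ k))

  k<m : k < m
  k<m = subst (k <_) k+k≡m (m<m+n k (≤-trans z<s 2≤k))

  m∸k≡k : m ∸ k ≡ k
  m∸k≡k = trans (cong (_∸ k) (sym k+k≡m)) (m+n∸m≡n k k)

  lipschitz : Lipschitz (cdist ∘ toℕ)
  lipschitz {x} {y} x~y with adj⇒ x~y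
  ... | inj₁ cyc  = cdist-adj cyc (toℕ<n x) (toℕ<n y)
  ... | inj₂ same = m≤n⇒m≤1+n (≤-reflexive (sym same))

  -- The argument is clamped at m only to make fromℕ< applicable; pos is used on s ≤ m.
  pos : ℕ → Fin m
  pos s = fromℕ< (unrot<m (m⊓n≤n s m))

  toℕ-pos : ∀ {s} → s ≤ m → toℕ (pos s) ≡ unrot s
  toℕ-pos s≤m = trans (toℕ-fromℕ< _) (cong unrot (m≤n⇒m⊓n≡m s≤m))

  pos-injective : ∀ {s s′} → s < m → s′ < m → pos s ≡ pos s′ → s ≡ s′
  pos-injective {s} {s′} s<m s′<m eq = begin
    s                 ≡⟨ sym (rot-unrot s<m) ⟩
    rot (unrot s)     ≡⟨ cong rot (trans (sym (toℕ-pos (<⇒≤ s<m)))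
                                           (trans (cong toℕ eq) (toℕ-pos (<⇒≤ s′<m)))) ⟩
    rot (unrot s′)    ≡⟨ rot-unrot s′<m ⟩
    s′                ∎
    where open ≡-Reasoning

  pos-adj : ∀ {s} → s < m → Adj K (pos s) (pos (suc s))
  pos-adj s<m = succ⇒adj (subst₂ (CycSucc m) (sym (toℕ-pos (<⇒≤ s<m))) (sym (toℕ-pos s<m)) (unrot-succ s<m))

  cdist-pos : ∀ {s} → s < m → cdist (toℕ (pos s)) ≡ cdist₀ s
  cdist-pos s<m = cong cdist₀ (trans (cong rot (toℕ-pos (<⇒≤ s<m))) (rot-unrot s<m))

  pos-m≡pos-0 : pos m ≡ pos 0
  pos-m≡pos-0 = toℕ-injective
    (trans (toℕ-pos ≤-refl) (trans unrot-m (trans (sym unrot-0) (sym (toℕ-pos z≤n)))))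

  clockwise anticlockwise : ℕ → Fin m
  clockwise     t = pos t
  anticlockwise t = pos (m ∸ t)

  clockwise-chain : Chain clockwise k
  clockwise-chain t t<k = pos-adj (<-trans t<k k<m)

  anticlockwise-chain : Chain anticlockwise k
  anticlockwise-chain t t<k =
    Adj-sym K (subst (λ z → Adj K (pos (m ∸ suc t)) (pos z)) (sym (+-∸-assoc 1 t<m)) (pos-adj m∸1+t<m))
    where
      t<m = <-trans t<k k<m
      m∸1+t<m : m ∸ suc t < m
      m∸1+t<m = ∸-monoʳ-< z<s t<m

  anticlockwise-k : anticlockwise k ≡ clockwise k
  anticlockwise-k = cong pos m∸k≡k

  clockwise-1≢anticlockwise-1 : clockwise 1 ≢ anticlockwise 1
  clockwise-1≢anticlockwise-1 eq = <⇒≢ 1<m∸1 (pos-injective 1<m (∸-monoʳ-< z<s (<⇒≤ 1<m)) eq)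
    where
      1<m : 1 < m
      1<m = <-trans (≤-trans (s≤s z<s) 2≤k) k<m
      1<m∸1 : 1 < m ∸ 1
      1<m∸1 = ≤-trans (s≤s (s≤s z≤n))
                (∸-monoˡ-≤ 1 (≤-trans (+-mono-≤ 2≤k 2≤k) (≤-reflexive k+k≡m)))

  geodesic : (w : Walk K (pos 0) (pos k)) → len w ≡ k → IsGeodesic w
  geodesic w len≡k = Lipschitz-tight⇒geodesic lipschitz w (≤-reflexive (begin
    cdist (toℕ (pos 0)) + len w  ≡⟨ cong₂ _+_ (cdist-pos 0<m) len≡k ⟩
    k                            ≡⟨ sym (⊓-idem k) ⟩
    k ⊓ k                        ≡⟨ cong (k ⊓_) (sym m∸k≡k) ⟩
    cdist₀ k                     ≡⟨ sym (cdist-pos k<m) ⟩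
    cdist (toℕ (pos k))          ∎))
    where open ≡-Reasoning

  notGeodetic : ¬ Geodetic K
  notGeodetic geo
    with chain⇒walk clockwise k clockwise-chain refl refl
       | chain⇒walk anticlockwise k anticlockwise-chain pos-m≡pos-0 anticlockwise-k
  ... | wx , lx , vx | wy , ly , vy =
    applyUpTo-differ₁ {f = clockwise} {anticlockwise} (≤-trans (s≤s z≤n) 2≤k)
                      clockwise-1≢anticlockwise-1 (begin
      applyUpTo clockwise (suc k)      ≡⟨ sym vx ⟩
      vertices wx                      ≡⟨ proj₂ (geo (pos 0) (pos k)) wx wy (geodesic wx lx) (geodesic wy ly) ⟩
      vertices wy                      ≡⟨ vy ⟩
      applyUpTo anticlockwise (suc k)  ∎)
    where open ≡-Reasoning

  pathFromStart : ∀ a → Walk K (pos 0) a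
  pathFromStart a with chain⇒walk pos (rot (toℕ a)) (λ t t< → pos-adj (<-trans t< (rot<m (toℕ<n a)))) refl
                         (toℕ-injective (trans (toℕ-pos (<⇒≤ (rot<m (toℕ<n a)))) (unrot-rot (toℕ<n a))))
  ... | w , _ = w

  connected : Connected K
  connected a b = reverseʷ (pathFromStart a) ++ʷ pathFromStart b

OddChordAt : ℕ → ℕ → ℕ → Set
OddChordAt m a b = a < b × 2 ≤ b ∸ a × b ∸ a + 2 ≤ m × Odd (b ∸ a + 1) × Odd (m ∸ (b ∸ a) + 1)

OddChordAt-midpoint : ∀ {m a b} → OddChordAt m a b → ∃ λ j → 1 ≤ j × b ≡ a + (j + j)
OddChordAt-midpoint {a = a} {b} (a<b , 2≤b-a , _ , (j , b-a+1≡1+2j) , _) = j , 1≤j , b≡a+2j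
  where
    b-a≡j+j : b ∸ a ≡ j + j
    b-a≡j+j = suc-injective (begin
      suc (b ∸ a)   ≡⟨ +-comm 1 (b ∸ a) ⟩
      b ∸ a + 1     ≡⟨ b-a+1≡1+2j ⟩
      suc (2 * j)   ≡⟨ cong (suc ∘ (j +_)) (+-identityʳ j) ⟩
      suc (j + j)   ∎)
      where open ≡-Reasoning
    b≡a+2j : b ≡ a + (j + j)
    b≡a+2j = trans (sym (m+[n∸m]≡n (<⇒≤ a<b))) (cong (a +_) b-a≡j+j)
    1≤j : 1 ≤ j
    1≤j = n≢0⇒n>0 λ { refl → contradiction (≤-trans 2≤b-a (≤-reflexive b-a≡j+j)) λ () }

oddChord-arith : ∀ {i d} → 0 < i → i < d → OddChordAt (2 * d) i (2 * d ∸ i)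
oddChord-arith {i} 0<i i<d with m≤n⇒∃[o]m+o≡n (<⇒≤ i<d)
... | s , refl = i<N∸i , 2≤arc , arc+2≤N , (s , trans (cong (_+ 1) N∸i∸i≡s+s) (s+s+1≡1+2s s)) ,
                 (i , trans (cong (_+ 1) N∸arc≡i+i) (s+s+1≡1+2s i))
  where
    2[i+s]≡i+[i+[s+s]] : ∀ i s → 2 * (i + s) ≡ i + (i + (s + s))
    2[i+s]≡i+[i+[s+s]] = solve-∀
    2[i+s]≡[i+i]+[s+s] : ∀ i s → 2 * (i + s) ≡ (i + i) + (s + s)
    2[i+s]≡[i+i]+[s+s] = solve-∀
    s+s+1≡1+2s : ∀ s → s + s + 1 ≡ suc (2 * s)
    s+s+1≡1+2s = solve-∀
    0<s : 0 < s
    0<s = +-cancelˡ-< i 0 s (subst (_< i + s) (sym (+-identityʳ i)) i<d)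
    N∸i≡ : 2 * (i + s) ∸ i ≡ i + (s + s)
    N∸i≡ = trans (cong (_∸ i) (2[i+s]≡i+[i+[s+s]] i s)) (m+n∸m≡n i (i + (s + s)))
    N∸i∸i≡s+s : 2 * (i + s) ∸ i ∸ i ≡ s + s
    N∸i∸i≡s+s = trans (cong (_∸ i) N∸i≡) (m+n∸m≡n i (s + s))
    N∸arc≡i+i : 2 * (i + s) ∸ (2 * (i + s) ∸ i ∸ i) ≡ i + i
    N∸arc≡i+i = trans (cong₂ _∸_ (2[i+s]≡[i+i]+[s+s] i s) N∸i∸i≡s+s) (m+n∸n≡m (i + i) (s + s))
    i<N∸i : i < 2 * (i + s) ∸ i
    i<N∸i = subst (i <_) (sym N∸i≡)
              (subst (_< i + (s + s)) (+-identityʳ i) (+-monoʳ-< i (≤-trans 0<s (m≤m+n s s))))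
    2≤arc : 2 ≤ 2 * (i + s) ∸ i ∸ i
    2≤arc = subst (2 ≤_) (sym N∸i∸i≡s+s) (+-mono-≤ 0<s 0<s)
    arc+2≤N : 2 * (i + s) ∸ i ∸ i + 2 ≤ 2 * (i + s)
    arc+2≤N = subst₂ _≤_ (cong (_+ 2) (sym N∸i∸i≡s+s)) (sym (2[i+s]≡[i+i]+[s+s] i s))
                (subst (_≤ (i + i) + (s + s)) (+-comm 2 (s + s)) (+-monoˡ-≤ (s + s) (+-mono-≤ 0<i 0<i)))

cdist-chordEnds : ∀ m a j (a+j<m : a + j < m) → 1 ≤ j →
                  Rotation.cdist m (a + j) a+j<m a ≡ Rotation.cdist m (a + j) a+j<m (a + (j + j))
cdist-chordEnds m a j a+j<m 1≤j = begin
  cdist₀ (rot a)                  ≡⟨ cong cdist₀ (rot-< a<a+j) ⟩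
  cdist₀ (a + m ∸ (a + j))        ≡⟨ cong cdist₀ ([m+n]∸[m+o]≡n∸o a m j) ⟩
  (m ∸ j) ⊓ (m ∸ (m ∸ j))         ≡⟨ cong ((m ∸ j) ⊓_) (m∸[m∸n]≡n j≤m) ⟩
  (m ∸ j) ⊓ j                     ≡⟨ ⊓-comm (m ∸ j) j ⟩
  cdist₀ j                        ≡⟨ cong cdist₀ (sym rot-a+2j) ⟩
  cdist₀ (rot (a + (j + j)))      ∎
  where
    open Rotation m (a + j) a+j<m
    open ≡-Reasoning
    a<a+j : a < a + j
    a<a+j = subst (_< a + j) (+-identityʳ a) (+-monoʳ-< a 1≤j)
    j≤m : j ≤ m
    j≤m = ≤-trans (m≤n+m j a) (<⇒≤ a+j<m)
    rot-a+2j : rot (a + (j + j)) ≡ j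
    rot-a+2j = trans (rot-≥ (+-monoʳ-≤ a (m≤m+n j j)))
                 (trans (cong (_∸ (a + j)) (sym (+-assoc a j j))) (m+n∸m≡n (a + j) j))

2≤2*k : ∀ {k} → 2 ≤ k → 2 ≤ 2 * k
2≤2*k {k} 2≤k = ≤-trans 2≤k (m≤m+n k (k + 0))

evenCycle-connected-¬geodetic : ∀ k → 2 ≤ k → Connected (Cycle (2 * k)) × ¬ Geodetic (Cycle (2 * k))
evenCycle-connected-¬geodetic k 2≤k = connected , notGeodetic
  where
    open AntipodalGeodesics k 2≤k 0 (≤-trans z<s (2≤2*k 2≤k)) (cycRel (2 * k))
           (λ cyc → Equivalence.from (Cycle-adj⇔ (2≤2*k 2≤k)) (inj₁ cyc))
           (inj₁ ∘ Equivalence.to (Cycle-adj⇔ (2≤2*k 2≤k)))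

oddChordedCycle-connected-¬geodetic : ∀ k → 2 ≤ k → ∀ a b → OddChord (2 * k) a b →
  Connected (ChordedCycle (2 * k) a b) × ¬ Geodetic (ChordedCycle (2 * k) a b)
oddChordedCycle-connected-¬geodetic k 2≤k a b oddChord@(a<b , _) with OddChordAt-midpoint oddChord
... | j , 1≤j , b≡a+2j = connected , notGeodetic
  where
    m = 2 * k
    a+j<m : toℕ a + j < m
    a+j<m = ≤-<-trans (+-monoʳ-≤ (toℕ a) (m≤m+n j j)) (subst (_< m) b≡a+2j (toℕ<n b))
    dist : ℕ → ℕ
    dist = Rotation.cdist m (toℕ a + j) a+j<m
    chordEnds : dist (toℕ a) ≡ dist (toℕ b)
    chordEnds = trans (cdist-chordEnds m (toℕ a) j a+j<m 1≤j) (cong dist (sym b≡a+2j))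
    adj⇔ = ChordedCycle-adj⇔ {a = a} {b} (2≤2*k 2≤k) (λ a≡b → <⇒≢ a<b (cong toℕ a≡b))
    adj⇒ : ∀ {x y} → Adj (ChordedCycle m a b) x y →
           CycAdj m (toℕ x) (toℕ y) ⊎ dist (toℕ x) ≡ dist (toℕ y)
    adj⇒ x~y with Equivalence.to adj⇔ x~y
    ... | inj₁ (inj₁ cyc)           = inj₁ (inj₁ cyc)
    ... | inj₁ (inj₂ (refl , refl)) = inj₂ chordEnds
    ... | inj₂ (inj₁ cyc)           = inj₁ (inj₂ cyc)
    ... | inj₂ (inj₂ (refl , refl)) = inj₂ (sym chordEnds)
    open AntipodalGeodesics k 2≤k (toℕ a + j) a+j<m (chordedCycRel m a b)
           (λ cyc → Equivalence.from adj⇔ (inj₁ (inj₁ cyc))) adj⇒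

connected-¬geodetic⇒FreeOf : ∀ {G H} → AllConnectedInducedGeodetic G → Connected H × ¬ Geodetic H → FreeOf H G
connected-¬geodetic⇒FreeOf allGeodetic (conn , ¬geo) H↪G = ¬geo (allGeodetic _ H↪G conn)

forward : ∀ G → AllConnectedInducedGeodetic G → FreeEvenCyclesAndOddChorded G
forward G allGeodetic =
  (λ k 2≤k → connected-¬geodetic⇒FreeOf allGeodetic (evenCycle-connected-¬geodetic k 2≤k)) ,
  (λ k 2≤k a b odd → connected-¬geodetic⇒FreeOf allGeodetic (oddChordedCycle-connected-¬geodetic k 2≤k a b odd))

module GeodesicSequences (H : Graph) where

  open Walks H

  DistAtLeast : V → V → ℕ → Set
  DistAtLeast a b L = ∀ (w : Walk H a b) → L ≤ len w

  GeoSeq : (ℕ → V) → ℕ → Set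
  GeoSeq x L = Chain x L × DistAtLeast (x 0) (x L) L

  UniqueGeodesics : ℕ → Set
  UniqueGeodesics L = ∀ {x y} → GeoSeq x L → GeoSeq y L → x 0 ≡ y 0 → x L ≡ y L →
                      ∀ {t} → t ≤ L → x t ≡ y t

  DistAtLeast-resp : ∀ {a a′ b b′ L} → a ≡ a′ → b ≡ b′ → DistAtLeast a b L → DistAtLeast a′ b′ L
  DistAtLeast-resp refl refl lb = lb

  IsGeodesic⇒GeoSeq : ∀ {a b} (p : Walk H a b) → IsGeodesic p → GeoSeq (vertexAt p) (len p)
  IsGeodesic⇒GeoSeq p p-geo = vertexAt-chain p , DistAtLeast-resp (sym (vertexAt-0 p)) (sym (vertexAt-len p)) p-geo

  Chain-take : ∀ {x L j} → Chain x L → j ≤ L → Chain x j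
  Chain-take ch j≤L t t<j = ch t (<-≤-trans t<j j≤L)

  Chain-drop : ∀ {x L i} → Chain x L → i ≤ L → Chain (λ t → x (i + t)) (L ∸ i)
  Chain-drop {x} {L} {i} ch i≤L t t<L∸i =
    subst (Adj H (x (i + t)) ∘ x) (sym (+-suc i t))
      (ch (i + t) (subst (i + t <_) (m+[n∸m]≡n i≤L) (+-monoʳ-< i t<L∸i)))

  walkAlong : ∀ {x L} → Chain x L → ∀ {i j a b} → i ≤ j → j ≤ L → x i ≡ a → x j ≡ b →
              Σ (Walk H a b) λ w → len w ≡ j ∸ i
  walkAlong {x} ch {i} {j} i≤j j≤L xi≡a xj≡b
    with chain⇒walk (λ t → x (i + t)) (j ∸ i) (Chain-drop (Chain-take ch j≤L) i≤j)
                    (trans (cong x (+-identityʳ i)) xi≡a) (trans (cong x (m+[n∸m]≡n i≤j)) xj≡b)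
  ... | w , len-w , _ = w , len-w

  GeoSeq-dist : ∀ {x L} → GeoSeq x L → ∀ {i j} → i ≤ j → j ≤ L → DistAtLeast (x i) (x j) (j ∸ i)
  GeoSeq-dist {x} {L} (ch , lb) {i} {j} i≤j j≤L w
    with walkAlong ch z≤n (≤-trans i≤j j≤L) refl refl | walkAlong ch j≤L ≤-refl refl refl
  ... | before , len-before | after , len-after =
    m≤n+o⇒m∸n≤o j i (+-cancelʳ-≤ (L ∸ j) j (i + len w) (begin
      j + (L ∸ j)                         ≡⟨ m+[n∸m]≡n j≤L ⟩
      L                                   ≤⟨ lb (before ++ʷ w ++ʷ after) ⟩
      len (before ++ʷ w ++ʷ after)        ≡⟨ len-++ʷ before (w ++ʷ after) ⟩
      len before + len (w ++ʷ after)      ≡⟨ cong₂ _+_ len-before (len-++ʷ w after) ⟩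
      i + (len w + len after)             ≡⟨ cong (λ l → i + (len w + l)) len-after ⟩
      i + (len w + (L ∸ j))               ≡⟨ sym (+-assoc i (len w) (L ∸ j)) ⟩
      i + len w + (L ∸ j)                 ∎))
    where open ≤-Reasoning

  GeoSeq-take : ∀ {x L j} → GeoSeq x L → j ≤ L → GeoSeq x j
  GeoSeq-take geo j≤L = Chain-take (proj₁ geo) j≤L , GeoSeq-dist geo z≤n j≤L

  GeoSeq-drop : ∀ {x L i} → GeoSeq x L → i ≤ L → GeoSeq (λ t → x (i + t)) (L ∸ i)
  GeoSeq-drop {x} {L} {i} geo i≤L =
    Chain-drop (proj₁ geo) i≤L ,
    DistAtLeast-resp (cong x (sym (+-identityʳ i))) (cong x (sym (m+[n∸m]≡n i≤L))) (GeoSeq-dist geo i≤L ≤-refl)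

  GeoSeq-index-≤ : ∀ {x y L L′} → GeoSeq x L → Chain y L′ → x 0 ≡ y 0 →
                   ∀ {i j} → i ≤ L → j ≤ L′ → x i ≡ y j → i ≤ j
  GeoSeq-index-≤ geo ch x0≡y0 {i} {j} i≤L j≤L′ xi≡yj
    with walkAlong ch z≤n j≤L′ (sym x0≡y0) (sym xi≡yj)
  ... | w , len-w = subst (i ≤_) len-w (GeoSeq-dist geo z≤n i≤L w)

  GeoSeq-injective : ∀ {x L} → GeoSeq x L → ∀ {i j} → i ≤ L → j ≤ L → x i ≡ x j → i ≡ j
  GeoSeq-injective geo i≤L j≤L xi≡xj =
    ≤-antisym (GeoSeq-index-≤ geo (proj₁ geo) refl i≤L j≤L xi≡xj)
              (GeoSeq-index-≤ geo (proj₁ geo) refl j≤L i≤L (sym xi≡xj))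

  GeoSeq-adj-< : ∀ {x L} → GeoSeq x L → ∀ {i j} → i < j → j ≤ L → Adj H (x i) (x j) → suc i ≡ j
  GeoSeq-adj-< geo {i} {j} i<j j≤L xi~xj = ≤-antisym i<j (begin
    j             ≡⟨ sym (m+[n∸m]≡n (<⇒≤ i<j)) ⟩
    i + (j ∸ i)   ≤⟨ +-monoʳ-≤ i (GeoSeq-dist geo (<⇒≤ i<j) j≤L (step xi~xj here)) ⟩
    i + 1         ≡⟨ +-comm i 1 ⟩
    suc i         ∎)
    where open ≤-Reasoning

  GeoSeq-adj : ∀ {x L} → GeoSeq x L → ∀ {i j} → i ≤ L → j ≤ L →
               Adj H (x i) (x j) → suc i ≡ j ⊎ suc j ≡ i
  GeoSeq-adj geo {i} {j} i≤L j≤L xi~xj with <-cmp i j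
  ... | tri< i<j _ _  = inj₁ (GeoSeq-adj-< geo i<j j≤L xi~xj)
  ... | tri≈ _ refl _ = contradiction xi~xj (Adj-irrefl H)
  ... | tri> _ _ j<i  = inj₂ (GeoSeq-adj-< geo j<i i≤L (Adj-sym H xi~xj))

module MinimalCounterexample (H : Graph) (d : ℕ)
  (shorterUnique : ∀ {d′} → d′ < d → GeodesicSequences.UniqueGeodesics H d′) where

  open Walks H
  open GeodesicSequences H

  module DistinctGeodesics (P Q : ℕ → V) (gP : GeoSeq P d) (gQ : GeoSeq Q d)
                           (P0≡Q0 : P 0 ≡ Q 0) (Pd≡Qd : P d ≡ Q d)
                           (P≢Q : ¬ (∀ {t} → t ≤ d → P t ≡ Q t)) where

    disjoint : ∀ {i} → 0 < i → i < d → P i ≢ Q i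
    disjoint {i} 0<i i<d Pi≡Qi = P≢Q agree
      where
        i≤d = <⇒≤ i<d
        agree : ∀ {t} → t ≤ d → P t ≡ Q t
        agree {t} t≤d with ≤-total t i
        ... | inj₁ t≤i = shorterUnique i<d (GeoSeq-take gP i≤d) (GeoSeq-take gQ i≤d) P0≡Q0 Pi≡Qi t≤i
        ... | inj₂ i≤t = subst (λ s → P s ≡ Q s) (m+[n∸m]≡n i≤t)
              (shorterUnique (∸-monoʳ-< 0<i i≤d) (GeoSeq-drop gP i≤d) (GeoSeq-drop gQ i≤d)
                 (subst (λ s → P s ≡ Q s) (sym (+-identityʳ i)) Pi≡Qi)
                 (subst (λ s → P s ≡ Q s) (sym (m+[n∸m]≡n i≤d)) Pd≡Qd)
                 (∸-monoˡ-≤ i t≤d))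

    index-match : ∀ {a b} → a ≤ d → b ≤ d → P a ≡ Q b → a ≡ b
    index-match a≤d b≤d Pa≡Qb =
      ≤-antisym (GeoSeq-index-≤ gP (proj₁ gQ) P0≡Q0 a≤d b≤d Pa≡Qb)
                (GeoSeq-index-≤ gQ (proj₁ gP) (sym P0≡Q0) b≤d a≤d (sym Pa≡Qb))

    Q-dist : ∀ {b} → b ≤ d → DistAtLeast (P 0) (Q b) b
    Q-dist b≤d = DistAtLeast-resp (sym P0≡Q0) refl (GeoSeq-dist gQ z≤n b≤d)

    -- Following P up to i and then w reaches Q j in j steps, so by minimality it is Q itself; hence P i ≡ Q i.
    no-shortcut : ∀ {i j} → 0 < i → i ≤ j → j < d → (w : Walk H (P i) (Q j)) → i + len w ≢ j
    no-shortcut {i} {j} 0<i i≤j j<d w i+len≡j = disjoint 0<i i<d (begin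
      P i   ≡⟨ sym (splice-≤ P i y ≤-refl) ⟩
      z i   ≡⟨ shorterUnique j<d z-geo (GeoSeq-take gQ (<⇒≤ j<d)) (trans z0≡P0 P0≡Q0) zj≡Qj i≤j ⟩
      Q i   ∎)
      where
        open ≡-Reasoning
        i<d = ≤-<-trans i≤j j<d
        y = vertexAt w
        z = splice P i y
        z0≡P0 : z 0 ≡ P 0
        z0≡P0 = splice-≤ P i y z≤n
        zj≡Qj : z j ≡ Q j
        zj≡Qj = begin
          z j               ≡⟨ cong z (sym i+len≡j) ⟩
          z (i + len w)     ≡⟨ splice-≥ P i y (sym (vertexAt-0 w)) (m≤m+n i (len w)) ⟩
          y (i + len w ∸ i) ≡⟨ cong y (m+n∸m≡n i (len w)) ⟩
          y (len w)         ≡⟨ vertexAt-len w ⟩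
          Q j               ∎
        z-geo : GeoSeq z j
        z-geo = subst (Chain z) i+len≡j
                  (splice-chain P i y (Chain-take (proj₁ gP) (<⇒≤ i<d)) (vertexAt-chain w) (sym (vertexAt-0 w))) ,
                DistAtLeast-resp (sym z0≡P0) (sym zj≡Qj) (Q-dist (<⇒≤ j<d))

    P-to-Q-dist : ∀ {i j} → 0 < i → i ≤ j → j < d → DistAtLeast (P i) (Q j) (suc (j ∸ i))
    P-to-Q-dist {i} {j} 0<i i≤j j<d w = ≮⇒≥ λ { (s≤s short) →
      no-shortcut 0<i i≤j j<d w (trans (cong (i +_) (≤-antisym short long)) (m+[n∸m]≡n i≤j)) }
      where
        before = walkAlong (proj₁ gP) z≤n (<⇒≤ (≤-<-trans i≤j j<d)) refl refl
        long : j ∸ i ≤ len w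
        long = m≤n+o⇒m∸n≤o j i (subst (j ≤_)
                 (trans (len-++ʷ (proj₁ before) w) (cong (_+ len w) (proj₂ before)))
                 (Q-dist (<⇒≤ j<d) (proj₁ before ++ʷ w)))

    rung-≥ : ∀ {a b} → 0 < a → a < d → b < d → Adj H (P a) (Q b) → b ≤ a
    rung-≥ {a} {b} 0<a a<d b<d Pa~Qb with ≤-total a b
    ... | inj₂ b≤a = b≤a
    ... | inj₁ a≤b = m∸n≡0⇒m≤n (n≤0⇒n≡0 (s≤s⁻¹ (P-to-Q-dist 0<a a≤b b<d (step Pa~Qb here))))

    Detour : ℕ → ℕ → (ℕ → V) → Set
    Detour i j x = GeoSeq x (suc (j ∸ i)) × x 0 ≡ P i × x (suc (j ∸ i)) ≡ Q j

    along-P-then-rung : ∀ {i j} → 0 < i → i < j → j < d → Adj H (P j) (Q j) →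
                        Detour i j (splice (P ∘ (i +_)) (j ∸ i) (edge (P j) (Q j)))
    along-P-then-rung {i} {j} 0<i i<j j<d Pj~Qj =
      (subst (Chain A) (+-comm D 1)
         (splice-chain (P ∘ (i +_)) D (edge (P j) (Q j))
                       (Chain-drop (Chain-take (proj₁ gP) (<⇒≤ j<d)) (<⇒≤ i<j)) (edge-chain Pj~Qj) i+D≡j) ,
       DistAtLeast-resp (sym A0≡Pi) (sym AL≡Qj) (P-to-Q-dist 0<i (<⇒≤ i<j) j<d)) ,
      A0≡Pi , AL≡Qj
      where
        D = j ∸ i
        A = splice (P ∘ (i +_)) D (edge (P j) (Q j))
        i+D≡j : P (i + D) ≡ P j
        i+D≡j = cong P (m+[n∸m]≡n (<⇒≤ i<j))
        A0≡Pi : A 0 ≡ P i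
        A0≡Pi = trans (splice-≤ (P ∘ (i +_)) D (edge (P j) (Q j)) z≤n) (cong P (+-identityʳ i))
        AL≡Qj : A (suc D) ≡ Q j
        AL≡Qj = trans (splice-≥ (P ∘ (i +_)) D (edge (P j) (Q j)) i+D≡j (n≤1+n D))
                      (cong (edge (P j) (Q j)) (trans (cong (_∸ D) (+-comm 1 D)) (m+n∸m≡n D 1)))

    rung-then-along-Q : ∀ {i j} → 0 < i → i < j → j < d → Adj H (P i) (Q i) →
                        Detour i j (splice (edge (P i) (Q i)) 1 (Q ∘ (i +_)))
    rung-then-along-Q {i} {j} 0<i i<j j<d Pi~Qi =
      (splice-chain (edge (P i) (Q i)) 1 (Q ∘ (i +_)) (edge-chain Pi~Qi)
         (Chain-drop (Chain-take (proj₁ gQ) (<⇒≤ j<d)) (<⇒≤ i<j)) Qi≡Qi+0 ,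
       DistAtLeast-resp refl (sym BL≡Qj) (P-to-Q-dist 0<i (<⇒≤ i<j) j<d)) ,
      refl , BL≡Qj
      where
        Qi≡Qi+0 = cong Q (sym (+-identityʳ i))
        BL≡Qj : splice (edge (P i) (Q i)) 1 (Q ∘ (i +_)) (suc (j ∸ i)) ≡ Q j
        BL≡Qj = trans (splice-≥ (edge (P i) (Q i)) 1 (Q ∘ (i +_)) Qi≡Qi+0 (s≤s z≤n))
                      (cong Q (m+[n∸m]≡n (<⇒≤ i<j)))

    -- The two detours are geodesics of length j − i + 1 < d with the same ends,
    -- but their second vertices P (i + 1) and Q i differ.
    no-two-rungs : ∀ {i j} → 0 < i → i < j → j < d → Adj H (P i) (Q i) → Adj H (P j) (Q j) → ⊥
    no-two-rungs {i} {j} 0<i i<j j<d Pi~Qi Pj~Qj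
      with along-P-then-rung 0<i i<j j<d Pj~Qj | rung-then-along-Q 0<i i<j j<d Pi~Qi
    ... | A-geo , A0≡Pi , AL≡Qj | B-geo , B0≡Pi , BL≡Qj =
      1+n≢n (index-match (<⇒≤ (≤-<-trans i<j j<d)) (<⇒≤ (<-trans i<j j<d)) (begin
        P (suc i)   ≡⟨ cong P (+-comm 1 i) ⟩
        P (i + 1)   ≡⟨ sym (splice-≤ (P ∘ (i +_)) (j ∸ i) (edge (P j) (Q j)) (m<n⇒0<n∸m i<j)) ⟩
        splice (P ∘ (i +_)) (j ∸ i) (edge (P j) (Q j)) 1
          ≡⟨ shorterUnique L<d A-geo B-geo (trans A0≡Pi (sym B0≡Pi)) (trans AL≡Qj (sym BL≡Qj)) (s≤s z≤n) ⟩
        splice (edge (P i) (Q i)) 1 (Q ∘ (i +_)) 1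
          ≡⟨⟩
        Q i         ∎))
      where
        open ≡-Reasoning
        L<d : suc (j ∸ i) < d
        L<d = ≤-<-trans (≤-trans (+-monoˡ-≤ (j ∸ i) 0<i) (≤-reflexive (m+[n∸m]≡n (<⇒≤ i<j)))) j<d

  module Counterexample (P Q : ℕ → V) (gP : GeoSeq P d) (gQ : GeoSeq Q d)
                        (P0≡Q0 : P 0 ≡ Q 0) (Pd≡Qd : P d ≡ Q d)
                        (P≢Q : ¬ (∀ {t} → t ≤ d → P t ≡ Q t)) where

    open DistinctGeodesics P Q gP gQ P0≡Q0 Pd≡Qd P≢Q
    module QP = DistinctGeodesics Q P gQ gP (sym P0≡Q0) (sym Pd≡Qd) (λ Q≡P → P≢Q (sym ∘ Q≡P))

    rung-straight : ∀ {a b} → 0 < a → a < d → 0 < b → b < d → Adj H (P a) (Q b) → a ≡ b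
    rung-straight 0<a a<d 0<b b<d Pa~Qb =
      ≤-antisym (QP.rung-≥ 0<b b<d a<d (Adj-sym H Pa~Qb)) (rung-≥ 0<a a<d b<d Pa~Qb)

    Rung : ℕ → Set
    Rung a = 0 < a × a < d × Adj H (P a) (Q a)

    rung-unique : ∀ {i j} → Rung i → Rung j → i ≡ j
    rung-unique {i} {j} (0<i , i<d , Pi~Qi) (0<j , j<d , Pj~Qj) with <-cmp i j
    ... | tri< i<j _ _ = ⊥-elim (no-two-rungs 0<i i<j j<d Pi~Qi Pj~Qj)
    ... | tri≈ _ i≡j _ = i≡j
    ... | tri> _ _ j<i = ⊥-elim (no-two-rungs 0<j j<i i<d Pj~Qj Pi~Qi)

    2≤d : 2 ≤ d
    2≤d = ≮⇒≥ λ d<2 → P≢Q (λ {t} t≤d → agree d<2 t (≤-trans t≤d (s≤s⁻¹ d<2)) t≤d)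
      where
        agree : d < 2 → ∀ t → t ≤ 1 → t ≤ d → P t ≡ Q t
        agree _   zero       _ _   = P0≡Q0
        agree d<2 (suc zero) _ 1≤d = subst (λ s → P s ≡ Q s) (≤-antisym (s≤s⁻¹ d<2) 1≤d) Pd≡Qd
        agree _   (suc (suc _)) (s≤s ()) _

    N : ℕ
    N = 2 * d

    N≡d+d : N ≡ d + d
    N≡d+d = cong (d +_) (+-identityʳ d)

    N∸d≡d : N ∸ d ≡ d
    N∸d≡d = trans (cong (_∸ d) N≡d+d) (m+n∸m≡n d d)

    d≤N : d ≤ N
    d≤N = m≤m+n d (d + 0)

    N∸y≤d : ∀ {y} → d ≤ y → N ∸ y ≤ d
    N∸y≤d d≤y = ≤-trans (∸-monoʳ-≤ N d≤y) (≤-reflexive N∸d≡d)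

    N∸y<d : ∀ {y} → d < y → y ≤ N → N ∸ y < d
    N∸y<d {y} d<y y≤N = subst (N ∸ y <_) N∸d≡d (∸-monoʳ-< d<y y≤N)

    glued : ℕ → V
    glued t with t ≤? d
    ... | yes _ = P t
    ... | no  _ = Q (N ∸ t)

    glued-≤ : ∀ {t} → t ≤ d → glued t ≡ P t
    glued-≤ {t} t≤d with t ≤? d
    ... | yes _   = refl
    ... | no  t≰d = contradiction t≤d t≰d

    glued-≥ : ∀ {t} → d ≤ t → glued t ≡ Q (N ∸ t)
    glued-≥ {t} d≤t with t ≤? d
    ... | no  _   = refl
    ... | yes t≤d with ≤-antisym t≤d d≤t
    ...   | refl = trans Pd≡Qd (cong Q (sym N∸d≡d))

    -- In the glued cycle the rung P a — Q a is the chord joining positions a and N − a.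
    RungEdge : ℕ → ℕ → Set
    RungEdge x y = (Rung x × y ≡ N ∸ x) ⊎ (Rung y × x ≡ N ∸ y)

    glued-adj-PP : ∀ {x y} → x ≤ d → y ≤ d → Adj H (glued x) (glued y) → CycAdj N x y
    glued-adj-PP x≤d y≤d gx~gy =
      Sum.map inj₁ inj₁ (GeoSeq-adj gP x≤d y≤d (subst₂ (Adj H) (glued-≤ x≤d) (glued-≤ y≤d) gx~gy))

    glued-adj-QQ : ∀ {x y} → d ≤ x → d ≤ y → x ≤ N → y ≤ N → Adj H (glued x) (glued y) → CycAdj N x y
    glued-adj-QQ d≤x d≤y x≤N y≤N gx~gy
      with GeoSeq-adj gQ (N∸y≤d d≤x) (N∸y≤d d≤y) (subst₂ (Adj H) (glued-≥ d≤x) (glued-≥ d≤y) gx~gy)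
    ... | inj₁ e = inj₂ (inj₁ (1+[m∸n]≡m∸o⇒1+o≡n x≤N y≤N e))
    ... | inj₂ e = inj₁ (inj₁ (1+[m∸n]≡m∸o⇒1+o≡n y≤N x≤N e))

    glued-adj-PQ : ∀ {x y} → x ≤ d → d < y → y < N → Adj H (glued x) (glued y) → CycAdj N x y ⊎ RungEdge x y
    glued-adj-PQ {x} {y} x≤d d<y y<N gx~gy =
      onP x x≤d (subst₂ (Adj H) (glued-≤ x≤d) (glued-≥ (<⇒≤ d<y)) gx~gy)
      where
        b = N ∸ y
        b<d = N∸y<d d<y (<⇒≤ y<N)
        onP : ∀ x → x ≤ d → Adj H (P x) (Q b) → CycAdj N x y ⊎ RungEdge x y
        onP zero _ P0~Qb with GeoSeq-adj gQ z≤n (<⇒≤ b<d) (subst (λ v → Adj H v (Q b)) P0≡Q0 P0~Qb)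
        ... | inj₁ 1≡b = inj₁ (inj₂ (inj₂ (refl , trans (cong (_+ y) 1≡b) (m∸n+n≡m (<⇒≤ y<N)))))
        onP (suc x) 1+x≤d Px~Qb with m≤n⇒m<n∨m≡n 1+x≤d
        ... | inj₂ refl with GeoSeq-adj gQ ≤-refl (<⇒≤ b<d) (subst (λ v → Adj H v (Q b)) Pd≡Qd Px~Qb)
        ...   | inj₁ 1+d≡b = contradiction (≤-trans (n≤1+n d) (≤-reflexive 1+d≡b)) (<⇒≱ b<d)
        ...   | inj₂ 1+b≡d =
          inj₁ (inj₁ (inj₁ (1+[m∸n]≡m∸o⇒1+o≡n (<⇒≤ y<N) d≤N (trans 1+b≡d (sym N∸d≡d)))))
        onP (suc x) 1+x≤d Px~Qb | inj₁ x<d =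
          inj₂ (inj₁ ((z<s , x<d , subst (Adj H (P (suc x)) ∘ Q) (sym 1+x≡b) Px~Qb) ,
                      trans (sym (m∸[m∸n]≡n (<⇒≤ y<N))) (cong (N ∸_) (sym 1+x≡b))))
          where 1+x≡b = rung-straight z<s x<d (m<n⇒0<n∸m y<N) b<d Px~Qb

    glued-adj⇒ : ∀ {x y} → x < N → y < N → Adj H (glued x) (glued y) → CycAdj N x y ⊎ RungEdge x y
    glued-adj⇒ {x} {y} x<N y<N gx~gy with ≤-<-connex x d | ≤-<-connex y d
    ... | inj₁ x≤d | inj₁ y≤d = inj₁ (glued-adj-PP x≤d y≤d gx~gy)
    ... | inj₁ x≤d | inj₂ d<y = glued-adj-PQ x≤d d<y y<N gx~gy
    ... | inj₂ d<x | inj₁ y≤d = Sum.map Sum.swap Sum.swap (glued-adj-PQ y≤d d<x x<N (Adj-sym H gx~gy))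
    ... | inj₂ d<x | inj₂ d<y = inj₁ (glued-adj-QQ (<⇒≤ d<x) (<⇒≤ d<y) (<⇒≤ x<N) (<⇒≤ y<N) gx~gy)

    glued-succ : ∀ {x y} → CycSucc N x y → y < N → Adj H (glued x) (glued y)
    glued-succ {x} (inj₁ refl) 1+x<N with ≤-<-connex (suc x) d
    ... | inj₁ 1+x≤d = subst₂ (Adj H) (sym (glued-≤ (≤-trans (n≤1+n x) 1+x≤d))) (sym (glued-≤ 1+x≤d))
                         (proj₁ gP x 1+x≤d)
    ... | inj₂ d<1+x = Adj-sym H (subst₂ (Adj H) (sym (glued-≥ (<⇒≤ d<1+x)))
                         (trans (cong Q (sym (+-∸-assoc 1 (<⇒≤ 1+x<N)))) (sym (glued-≥ (s≤s⁻¹ d<1+x))))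
                         (proj₁ gQ (N ∸ suc x) (N∸y<d d<1+x (<⇒≤ 1+x<N))))
    glued-succ {x} (inj₂ (refl , 1+x≡N)) _ =
      Adj-sym H (subst₂ (Adj H) (trans (sym P0≡Q0) (sym (glued-≤ z≤n)))
                                (trans (cong Q (sym N∸x≡1)) (sym (glued-≥ d≤x)))
                  (proj₁ gQ 0 (≤-trans (s≤s z≤n) 2≤d)))
      where
        N∸x≡1 : N ∸ x ≡ 1
        N∸x≡1 = trans (cong (_∸ x) (sym 1+x≡N)) (m+n∸n≡m 1 x)
        d<N : d < N
        d<N = subst (d <_) (sym N≡d+d) (m<m+n d (≤-trans (s≤s z≤n) 2≤d))
        d≤x : d ≤ x
        d≤x = s≤s⁻¹ (subst (d <_) (sym 1+x≡N) d<N)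

    glued-rung : ∀ {x} → Rung x → Adj H (glued x) (glued (N ∸ x))
    glued-rung {x} (_ , x<d , Px~Qx) =
      subst₂ (Adj H) (sym (glued-≤ (<⇒≤ x<d)))
                     (sym (trans (glued-≥ d≤N∸x) (cong Q (m∸[m∸n]≡n (≤-trans (<⇒≤ x<d) d≤N))))) Px~Qx
      where
        d≤N∸x : d ≤ N ∸ x
        d≤N∸x = subst (_≤ N ∸ x) N∸d≡d (∸-monoʳ-≤ N (<⇒≤ x<d))

    glued-adj⇐ : ∀ {x y} → x < N → y < N → CycAdj N x y ⊎ RungEdge x y → Adj H (glued x) (glued y)
    glued-adj⇐ x<N y<N (inj₁ (inj₁ x→y))           = glued-succ x→y y<N
    glued-adj⇐ x<N y<N (inj₁ (inj₂ y→x))           = Adj-sym H (glued-succ y→x x<N)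
    glued-adj⇐ x<N y<N (inj₂ (inj₁ (rung , refl))) = glued-rung rung
    glued-adj⇐ x<N y<N (inj₂ (inj₂ (rung , refl))) = Adj-sym H (glued-rung rung)

    P-side≢Q-side : ∀ {x y} → x ≤ d → d < y → y < N → P x ≢ Q (N ∸ y)
    P-side≢Q-side {x} {y} x≤d d<y y<N Px≡Q = disjoint 0<x x<d (trans Px≡Q (cong Q (sym x≡N∸y)))
      where
        x≡N∸y = index-match x≤d (N∸y≤d (<⇒≤ d<y)) Px≡Q
        0<x = subst (0 <_) (sym x≡N∸y) (m<n⇒0<n∸m y<N)
        x<d = subst (_< d) (sym x≡N∸y) (N∸y<d d<y (<⇒≤ y<N))

    glued-injective : ∀ {x y} → x < N → y < N → glued x ≡ glued y → x ≡ y
    glued-injective {x} {y} x<N y<N gx≡gy with ≤-<-connex x d | ≤-<-connex y d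
    ... | inj₁ x≤d | inj₁ y≤d =
      GeoSeq-injective gP x≤d y≤d (trans (sym (glued-≤ x≤d)) (trans gx≡gy (glued-≤ y≤d)))
    ... | inj₁ x≤d | inj₂ d<y =
      contradiction (trans (sym (glued-≤ x≤d)) (trans gx≡gy (glued-≥ (<⇒≤ d<y))))
                    (P-side≢Q-side x≤d d<y y<N)
    ... | inj₂ d<x | inj₁ y≤d =
      contradiction (trans (sym (glued-≤ y≤d)) (trans (sym gx≡gy) (glued-≥ (<⇒≤ d<x))))
                    (P-side≢Q-side y≤d d<x x<N)
    ... | inj₂ d<x | inj₂ d<y = ∸-cancelˡ-≡ (<⇒≤ x<N) (<⇒≤ y<N)
      (GeoSeq-injective gQ (N∸y≤d (<⇒≤ d<x)) (N∸y≤d (<⇒≤ d<y))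
        (trans (sym (glued-≥ (<⇒≤ d<x))) (trans gx≡gy (glued-≥ (<⇒≤ d<y)))))

    glued↪ : (r : Fin N → Fin N → Bool) →
             (∀ {u v} → Adj (fromRel N r) u v ⇔ (CycAdj N (toℕ u) (toℕ v) ⊎ RungEdge (toℕ u) (toℕ v))) →
             fromRel N r ↪ H
    glued↪ r adj⇔ = record
      { f      = glued ∘ toℕ
      ; inj    = λ {u} {v} gu≡gv → toℕ-injective (glued-injective (toℕ<n u) (toℕ<n v) gu≡gv)
      ; adjPre = λ u v → T-⇔⇒≡ (mk⇔ (glued-adj⇐ (toℕ<n u) (toℕ<n v) ∘ Equivalence.to adj⇔)
                                    (Equivalence.from adj⇔ ∘ glued-adj⇒ (toℕ<n u) (toℕ<n v)))
      }

    2≤N : 2 ≤ N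
    2≤N = 2≤2*k 2≤d

    evenCycle↪ : (∀ {i} → ¬ Rung i) → Cycle N ↪ H
    evenCycle↪ noRung = glued↪ (cycRel N)
      (mk⇔ (inj₁ ∘ Equivalence.to (Cycle-adj⇔ 2≤N)) (Equivalence.from (Cycle-adj⇔ 2≤N) ∘ onlyCycle))
      where
        onlyCycle : ∀ {x y} → CycAdj N x y ⊎ RungEdge x y → CycAdj N x y
        onlyCycle (inj₁ cyc)               = cyc
        onlyCycle (inj₂ (inj₁ (rung , _))) = contradiction rung noRung
        onlyCycle (inj₂ (inj₂ (rung , _))) = contradiction rung noRung

    oddChordedCycle↪ : ∀ {i} → Rung i → ∃ λ a → ∃ λ b → OddChord N a b × ChordedCycle N a b ↪ H
    oddChordedCycle↪ {i} rung@(0<i , i<d , _) = a , b , oddChord , glued↪ (chordedCycRel N a b) (mk⇔ to from)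
      where
        i<N = <-≤-trans i<d d≤N
        N∸i<N = ∸-monoʳ-< 0<i (<⇒≤ i<N)
        a b : Fin N
        a = fromℕ< i<N
        b = fromℕ< N∸i<N
        toℕ-a : toℕ a ≡ i
        toℕ-a = toℕ-fromℕ< i<N
        toℕ-b : toℕ b ≡ N ∸ toℕ a
        toℕ-b = trans (toℕ-fromℕ< N∸i<N) (cong (N ∸_) (sym toℕ-a))
        rung-a : Rung (toℕ a)
        rung-a = subst Rung (sym toℕ-a) rung
        oddChord : OddChord N a b
        oddChord = subst₂ (OddChordAt N) (sym toℕ-a) (sym (trans toℕ-b (cong (N ∸_) toℕ-a)))
                     (oddChord-arith 0<i i<d)
        a≢b : a ≢ b
        a≢b a≡b = <⇒≢ (proj₁ oddChord) (cong toℕ a≡b)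
        adj⇔ = ChordedCycle-adj⇔ {a = a} {b} 2≤N a≢b
        toRung : ∀ {u v} → ChordSucc N a b u v → CycAdj N (toℕ u) (toℕ v) ⊎ RungEdge (toℕ u) (toℕ v)
        toRung (inj₁ cyc)         = inj₁ (inj₁ cyc)
        toRung (inj₂ (refl , refl)) = inj₂ (inj₁ (rung-a , toℕ-b))
        fromRung : ∀ {u v} → Rung (toℕ u) → toℕ v ≡ N ∸ toℕ u → ChordSucc N a b u v
        fromRung {u} {v} rung-u v≡N∸u =
          inj₂ (u≡a , toℕ-injective (trans v≡N∸u (trans (cong ((N ∸_) ∘ toℕ) u≡a) (sym toℕ-b))))
          where u≡a = toℕ-injective (trans (rung-unique rung-u rung) (sym toℕ-a))
        to : ∀ {u v} → Adj (ChordedCycle N a b) u v → CycAdj N (toℕ u) (toℕ v) ⊎ RungEdge (toℕ u) (toℕ v)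
        to u~v with Equivalence.to adj⇔ u~v
        ... | inj₁ u→v = toRung u→v
        ... | inj₂ v→u = Sum.map Sum.swap Sum.swap (toRung v→u)
        from : ∀ {u v} → CycAdj N (toℕ u) (toℕ v) ⊎ RungEdge (toℕ u) (toℕ v) → Adj (ChordedCycle N a b) u v
        from (inj₁ (inj₁ cyc)) = Equivalence.from adj⇔ (inj₁ (inj₁ cyc))
        from (inj₁ (inj₂ cyc)) = Equivalence.from adj⇔ (inj₂ (inj₁ cyc))
        from (inj₂ (inj₁ (rung-u , v≡N∸u))) = Equivalence.from adj⇔ (inj₁ (fromRung rung-u v≡N∸u))
        from (inj₂ (inj₂ (rung-v , u≡N∸v))) = Equivalence.from adj⇔ (inj₂ (fromRung rung-v u≡N∸v))

    rung? : ∀ a → Dec (Rung a)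
    rung? a = 0 <? a ×-dec a <? d ×-dec T? (adj H (P a) (Q a))

    refuted : FreeEvenCyclesAndOddChorded H → ⊥
    refuted (noEvenCycle , noOddChordedCycle) with anyUpTo? rung? d
    ... | yes (_ , _ , rung) with oddChordedCycle↪ rung
    ...   | a , b , oddChord , C↪H = noOddChordedCycle d 2≤d a b oddChord C↪H
    refuted (noEvenCycle , _) | no noRung =
      noEvenCycle d 2≤d (evenCycle↪ λ rung → noRung (_ , proj₁ (proj₂ rung) , rung))

module FreeGraphs (H : Graph) (free : FreeEvenCyclesAndOddChorded H) where

  open Walks H
  open GeodesicSequences H

  geodesics-unique : ∀ d → UniqueGeodesics d
  geodesics-unique = <-rec UniqueGeodesics λ d shorterUnique {x} {y} gx gy x0≡y0 xd≡yd {t} t≤d →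
    decidable-stable (x t ≟ᶠ y t) λ xt≢yt →
      MinimalCounterexample.Counterexample.refuted H d shorterUnique x y gx gy x0≡y0 xd≡yd
        (λ agree → xt≢yt (agree t≤d)) free

  walkOfLength? : ∀ L u v → Dec (∃ λ (w : Walk H u v) → len w ≡ L)
  walkOfLength? zero u v with u ≟ᶠ v
  ... | yes refl = yes (here , refl)
  ... | no  u≢v  = no λ { (here , _) → u≢v refl ; (step _ _ , ()) }
  walkOfLength? (suc L) u v with any? (λ w → T? (adj H u w) ×-dec walkOfLength? L w v)
  ... | yes (w , u~w , p , len-p) = yes (step u~w p , cong suc len-p)
  ... | no  none = no λ { (here , ()) ; (step {w = w} u~w p , len-p) → none (w , u~w , p , suc-injective len-p) }

  shortestWalk : ∀ B {u v} (w : Walk H u v) → len w ≤ B → Σ (Walk H u v) IsGeodesic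
  shortestWalk zero    w w≤0 = w , λ q → ≤-trans w≤0 z≤n
  shortestWalk (suc B) {u} {v} w w≤1+B with anyUpTo? (λ l → walkOfLength? l u v) (len w)
  ... | yes (_ , w′<w , w′ , refl) = shortestWalk B w′ (s≤s⁻¹ (<-≤-trans w′<w w≤1+B))
  ... | no  noShorter = w , λ q → ≮⇒≥ λ q<w → noShorter (len q , q<w , q , refl)

  geodesic-vertices-unique : ∀ {u v} (p q : Walk H u v) → IsGeodesic p → IsGeodesic q → vertices p ≡ vertices q
  geodesic-vertices-unique p q p-geo q-geo = begin
    vertices p                                   ≡⟨ vertices-vertexAt p ⟩
    applyUpTo (vertexAt p) (suc (len p))         ≡⟨ applyUpTo-cong (suc (len p)) (agree ∘ s≤s⁻¹) ⟩
    applyUpTo (vertexAt q) (suc (len p))         ≡⟨ cong (applyUpTo (vertexAt q) ∘ suc) len-p≡len-q ⟩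
    applyUpTo (vertexAt q) (suc (len q))         ≡⟨ sym (vertices-vertexAt q) ⟩
    vertices q                                   ∎
    where
      open ≡-Reasoning
      len-p≡len-q = ≤-antisym (p-geo q) (q-geo p)
      agree : ∀ {t} → t ≤ len p → vertexAt p t ≡ vertexAt q t
      agree = geodesics-unique (len p) (IsGeodesic⇒GeoSeq p p-geo)
                (subst (GeoSeq (vertexAt q)) (sym len-p≡len-q) (IsGeodesic⇒GeoSeq q q-geo))
                (trans (vertexAt-0 p) (sym (vertexAt-0 q)))
                (trans (vertexAt-len p) (sym (trans (cong (vertexAt q) len-p≡len-q) (vertexAt-len q))))

  geodetic : Connected H → Geodetic H
  geodetic connected u v =
    shortestWalk (len (connected u v)) (connected u v) ≤-refl , geodesic-vertices-unique

backward : ∀ G → FreeEvenCyclesAndOddChorded G → AllConnectedInducedGeodetic G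
backward G (noEvenCycle , noOddChordedCycle) H H↪G =
  FreeGraphs.geodetic H ((λ k 2≤k C↪H → noEvenCycle k 2≤k (↪-trans C↪H H↪G)) ,
                         (λ k 2≤k a b odd C↪H → noOddChordedCycle k 2≤k a b odd (↪-trans C↪H H↪G)))

lemma13 : ∀ (G : Graph) → AllConnectedInducedGeodetic G ⇔ FreeEvenCyclesAndOddChorded G
lemma13 G = mk⇔ (forward G) (backward G)
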